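{- Let $G$ be a clique simplicial graph. Then $\alpha(G)\cdot\omega(G)\ge |V(G)|$.
   Context: A vertex $v$ is simplicial if $N[v]$ is a clique; a simplicial clique is a clique equal to $N[v]$ for some simplicial vertex $v$. $G$ is clique simplicial if every inclusion-maximal clique of $G$ is a simplicial clique. $\alpha(G)$ and $\omega(G)$ denote the maximum sizes of a stable set and of a clique in $G$. -}

module Defs where

open import Data.Nat using (ℕ; _≤_)
open import Data.Bool using (Bool; true; false)
open import Data.Fin using (Fin)
open import Data.Fin.Subset using (Subset; _∈_; _∉_; ∣_∣)
open import Data.Product using (Σ; _×_; ∃)
open import Relation.Binary.PropositionalEquality using (_≡_; _≢_)
open import Relation.Nullary using (¬_)

record Graph (n : ℕ) : Set where
  field
    adj   : Fin n → Fin n → Bool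
    sym   : ∀ u v → adj u v ≡ adj v u
    irrefl : ∀ v → adj v v ≡ false

open Graph public

module _ {n : ℕ} (G : Graph n) where

  Adj : Fin n → Fin n → Set
  Adj u v = adj G u v ≡ true

  IsClique : Subset n → Set
  IsClique S = ∀ u v → u ∈ S → v ∈ S → u ≢ v → Adj u v

  IsStable : Subset n → Set
  IsStable S = ∀ u v → u ∈ S → v ∈ S → ¬ Adj u v

  IsMaximalClique : Subset n → Set
  IsMaximalClique C =
    IsClique C × (∀ D → IsClique D → (∀ x → x ∈ C → x ∈ D) → ∀ x → x ∈ D → x ∈ C)

  InClosedNbhd : Fin n → Fin n → Set
  InClosedNbhd v u = (u ≡ v) Data.Sum.⊎ Adj v u
    where import Data.Sum

  IsSimplicial : Fin n → Set
  IsSimplicial v = ∀ u w → InClosedNbhd v u → InClosedNbhd v w → u ≢ w → Adj u w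

  IsSimplicialClique : Subset n → Set
  IsSimplicialClique C =
    ∃ λ v → IsSimplicial v × (∀ u → (u ∈ C → InClosedNbhd v u) × (InClosedNbhd v u → u ∈ C))

  IsCliqueSimplicial : Set
  IsCliqueSimplicial = ∀ C → IsMaximalClique C → IsSimplicialClique C

  IsStabilityNumber : ℕ → Set
  IsStabilityNumber k = (∃ λ S → IsStable S × ∣ S ∣ ≡ k) × (∀ S → IsStable S → ∣ S ∣ ≤ k)

  IsCliqueNumber : ℕ → Set
  IsCliqueNumber k = (∃ λ S → IsClique S × ∣ S ∣ ≡ k) × (∀ S → IsClique S → ∣ S ∣ ≤ k)

-- Every vertex lies in a maximal clique, hence in N[v] for some simplicial v.
-- If t is simplicial and s ∈ N[t] then N[t] ⊆ N[s]; so the simplicial vertices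
-- having no smaller simplicial neighbour form a stable set L whose closed
-- neighbourhoods, cliques of size at most ω, still cover V: |V| ≤ |L| ω ≤ α ω.
module Submission where

open import Defs

open import Data.Nat using (ℕ; _≤_; _*_; _+_; z≤n; s≤s)
open import Data.Nat.Properties using (≤-trans; +-mono-≤; m≤n⇒m≤1+n; +-suc; ≤-reflexive; *-monoˡ-≤; module ≤-Reasoning)
open import Data.Bool using (true)
import Data.Bool.Properties as Bool
open import Data.Fin using (Fin; zero; suc; _<_; _<?_)
open import Data.Fin.Properties using (_≟_; all?; any?; <-cmp)
open import Data.Fin.Induction using (<-wellFounded)
open import Data.Fin.Subset using (Subset; inside; outside; _∈_; _⊆_; _⊃_; _∪_; ⊥; ⊤; ⁅_⁆; ∣_∣)
open import Data.Fin.Subset.Induction using (⊃-wellFounded)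
open import Data.Fin.Subset.Properties using (x∈p∪q⁺; p⊆q⇒∣p∣≤∣q∣; ∣⊤∣≡n; ∣⊥∣≡0; _∈?_; _⊂?_; anySubset?; x∈⁅x⁆; x∈⁅y⁆⇒x≡y)
open import Data.Vec using ([]; _∷_; tabulate; here; there)
open import Data.Vec.Properties using (lookup∘tabulate; lookup⇒[]=; []=⇒lookup)
open import Data.Product using (∃; _×_; _,_; proj₁)
open import Data.Sum using (inj₁; inj₂)
open import Data.Empty using (⊥-elim)
open import Function using (_∘_)
open import Level using (Level)
open import Relation.Binary.PropositionalEquality using (_≡_; refl; trans) renaming (sym to ≡-sym)
open import Relation.Nullary using (¬_; Dec; yes; no; does)
open import Relation.Nullary.Decidable using (_×-dec_; _⊎-dec_; _→-dec_; ¬?; dec-true)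
open import Relation.Binary.Definitions using (tri<; tri≈; tri>)
open import Induction.WellFounded using (Acc; acc)
open import Relation.Unary using (Pred; Decidable)

private
  variable
    ℓ : Level
    k n : ℕ

subset : {P : Pred (Fin n) ℓ} → Decidable P → Subset n
subset P? = tabulate (does ∘ P?)

module _ {P : Pred (Fin n) ℓ} (P? : Decidable P) where

  ∈-subset⁺ : ∀ {x} → P x → x ∈ subset P?
  ∈-subset⁺ {x} px = lookup⇒[]= x _ (trans (lookup∘tabulate _ x) (dec-true (P? x) px))

  ∈-subset⁻ : ∀ {x} → x ∈ subset P? → P x
  ∈-subset⁻ {x} x∈ = witness (P? x) (trans (≡-sym (lookup∘tabulate _ x)) ([]=⇒lookup x∈))
    where
    witness : ∀ {A : Set ℓ} (a? : Dec A) → does a? ≡ true → A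
    witness (yes a) _ = a

∣p∪q∣≤∣p∣+∣q∣ : ∀ (p q : Subset n) → ∣ p ∪ q ∣ ≤ ∣ p ∣ + ∣ q ∣
∣p∪q∣≤∣p∣+∣q∣ []            []            = z≤n
∣p∪q∣≤∣p∣+∣q∣ (outside ∷ p) (outside ∷ q) = ∣p∪q∣≤∣p∣+∣q∣ p q
∣p∪q∣≤∣p∣+∣q∣ (outside ∷ p) (inside  ∷ q) =
  ≤-trans (s≤s (∣p∪q∣≤∣p∣+∣q∣ p q)) (≤-reflexive (≡-sym (+-suc _ _)))
∣p∪q∣≤∣p∣+∣q∣ (inside  ∷ p) (outside ∷ q) = s≤s (∣p∪q∣≤∣p∣+∣q∣ p q)
∣p∪q∣≤∣p∣+∣q∣ (inside  ∷ p) (inside  ∷ q) =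
  s≤s (≤-trans (m≤n⇒m≤1+n (∣p∪q∣≤∣p∣+∣q∣ p q)) (≤-reflexive (≡-sym (+-suc _ _))))

⋃⟨_⟩ : Subset k → (Fin k → Subset n) → Subset n
⋃⟨ [] ⟩          N = ⊥
⋃⟨ outside ∷ T ⟩ N = ⋃⟨ T ⟩ (N ∘ suc)
⋃⟨ inside  ∷ T ⟩ N = N zero ∪ ⋃⟨ T ⟩ (N ∘ suc)

x∈⋃⟨T⟩ : ∀ {T : Subset k} {N : Fin k → Subset n} {t x} → t ∈ T → x ∈ N t → x ∈ ⋃⟨ T ⟩ N
x∈⋃⟨T⟩ {T = inside  ∷ T} here        x∈Nt = x∈p∪q⁺ (inj₁ x∈Nt)
x∈⋃⟨T⟩ {T = inside  ∷ T} (there t∈T) x∈Nt = x∈p∪q⁺ (inj₂ (x∈⋃⟨T⟩ t∈T x∈Nt))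
x∈⋃⟨T⟩ {T = outside ∷ T} (there t∈T) x∈Nt = x∈⋃⟨T⟩ t∈T x∈Nt

∣⋃⟨T⟩∣≤∣T∣*w : ∀ (T : Subset k) (N : Fin k → Subset n) {w} →
               (∀ {t} → t ∈ T → ∣ N t ∣ ≤ w) → ∣ ⋃⟨ T ⟩ N ∣ ≤ ∣ T ∣ * w
∣⋃⟨T⟩∣≤∣T∣*w {n = n} []    N bound = ≤-reflexive (∣⊥∣≡0 n)
∣⋃⟨T⟩∣≤∣T∣*w (outside ∷ T) N bound = ∣⋃⟨T⟩∣≤∣T∣*w T (N ∘ suc) (bound ∘ there)
∣⋃⟨T⟩∣≤∣T∣*w (inside  ∷ T) N bound = ≤-trans (∣p∪q∣≤∣p∣+∣q∣ (N zero) _)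
  (+-mono-≤ (bound here) (∣⋃⟨T⟩∣≤∣T∣*w T (N ∘ suc) (bound ∘ there)))

covering⇒n≤∣T∣*w : ∀ (T : Subset k) (N : Fin k → Subset n) {w} →
                   (∀ x → ∃ λ t → t ∈ T × x ∈ N t) → (∀ {t} → t ∈ T → ∣ N t ∣ ≤ w) → n ≤ ∣ T ∣ * w
covering⇒n≤∣T∣*w {n = n} T N covers bound = begin
  n              ≡⟨ ≡-sym (∣⊤∣≡n n) ⟩
  ∣ ⊤ {n} ∣      ≤⟨ p⊆q⇒∣p∣≤∣q∣ ⊤⊆⋃ ⟩
  ∣ ⋃⟨ T ⟩ N ∣   ≤⟨ ∣⋃⟨T⟩∣≤∣T∣*w T N bound ⟩
  ∣ T ∣ * _      ∎
  where
  open ≤-Reasoning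
  ⊤⊆⋃ : ⊤ {n} ⊆ ⋃⟨ T ⟩ N
  ⊤⊆⋃ {x} _ with covers x
  ... | t , t∈T , x∈Nt = x∈⋃⟨T⟩ t∈T x∈Nt

module _ {n : ℕ} (G : Graph n) where

  Adj? : ∀ u v → Dec (Adj G u v)
  Adj? u v = adj G u v Bool.≟ true

  Adj-sym : ∀ {u v} → Adj G u v → Adj G v u
  Adj-sym {u} {v} uv = trans (sym G v u) uv

  Adj-irrefl : ∀ {u} → ¬ Adj G u u
  Adj-irrefl {u} uu with () ← trans (≡-sym uu) (irrefl G u)

  InClosedNbhd? : ∀ v → Decidable (InClosedNbhd G v)
  InClosedNbhd? v u = (u ≟ v) ⊎-dec Adj? v u

  IsSimplicial? : Decidable (IsSimplicial G)
  IsSimplicial? v = all? λ u → all? λ w →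
    InClosedNbhd? v u →-dec (InClosedNbhd? v w →-dec (¬? (u ≟ w) →-dec Adj? u w))

  IsClique? : Decidable (IsClique G)
  IsClique? S = all? λ u → all? λ v →
    (u ∈? S) →-dec ((v ∈? S) →-dec (¬? (u ≟ v) →-dec Adj? u v))

  ⁅⁆-isClique : ∀ x → IsClique G ⁅ x ⁆
  ⁅⁆-isClique x u v u∈ v∈ u≢v =
    ⊥-elim (u≢v (trans (x∈⁅y⁆⇒x≡y x u∈) (≡-sym (x∈⁅y⁆⇒x≡y x v∈))))

  ⊆-maximalClique : ∀ {C} → IsClique G C → ∃ λ M → IsMaximalClique G M × C ⊆ M
  ⊆-maximalClique {C} = go C (⊃-wellFounded C)
    where
    go : ∀ C → Acc _⊃_ C → IsClique G C → ∃ λ M → IsMaximalClique G M × C ⊆ M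
    go C (acc rec) C-clique with anySubset? (λ D → IsClique? D ×-dec C ⊂? D)
    ... | yes (D , D-clique , C⊂D) with go D (rec C⊂D) D-clique
    ...   | M , M-maximal , D⊆M = M , M-maximal , D⊆M ∘ proj₁ C⊂D
    go C _ C-clique | no ∄superclique = C , (C-clique , maximal) , λ x∈C → x∈C
      where
      maximal : ∀ D → IsClique G D → (∀ x → x ∈ C → x ∈ D) → ∀ x → x ∈ D → x ∈ C
      maximal D D-clique C⊆D x x∈D with x ∈? C
      ... | yes x∈C = x∈C
      ... | no  x∉C = ⊥-elim (∄superclique (D , D-clique , (λ {y} → C⊆D y) , x , x∈D , x∉C))

  cliqueSimplicial⇒∈-simplicialNbhd : IsCliqueSimplicial G →
    ∀ x → ∃ λ v → IsSimplicial G v × InClosedNbhd G v x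
  cliqueSimplicial⇒∈-simplicialNbhd cs x with ⊆-maximalClique (⁅⁆-isClique x)
  ... | M , M-maximal , ⁅x⁆⊆M with cs M M-maximal
  ...   | v , v-simplicial , M≡N[v] = v , v-simplicial , proj₁ (M≡N[v] x) (⁅x⁆⊆M (x∈⁅x⁆ x))

  simplicial⇒nbhd⊆ : ∀ {t s} → IsSimplicial G t → InClosedNbhd G t s →
    ∀ x → InClosedNbhd G t x → InClosedNbhd G s x
  simplicial⇒nbhd⊆ t-simp (inj₁ refl) x x∈N[t] = x∈N[t]
  simplicial⇒nbhd⊆ t-simp (inj₂ ts) x (inj₁ refl) = inj₂ (Adj-sym ts)
  simplicial⇒nbhd⊆ {s = s} t-simp (inj₂ ts) x (inj₂ tx) with x ≟ s
  ... | yes x≡s = inj₁ x≡s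
  ... | no  x≢s = inj₂ (t-simp s x (inj₂ ts) (inj₂ tx) (x≢s ∘ ≡-sym))

  -- the least vertex of its class under adjacency, an equivalence on simplicial vertices
  IsLeader : Fin n → Set
  IsLeader t = IsSimplicial G t × (∀ s → s < t → IsSimplicial G s → ¬ Adj G s t)

  IsLeader? : Decidable IsLeader
  IsLeader? t = IsSimplicial? t ×-dec
    all? (λ s → (s <? t) →-dec (IsSimplicial? s →-dec ¬? (Adj? s t)))

  leader-above : ∀ v → IsSimplicial G v →
    ∃ λ t → IsLeader t × (∀ x → InClosedNbhd G v x → InClosedNbhd G t x)
  leader-above v = go v (<-wellFounded v)
    where
    go : ∀ v → Acc _<_ v → IsSimplicial G v →
      ∃ λ t → IsLeader t × (∀ x → InClosedNbhd G v x → InClosedNbhd G t x)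
    go v (acc rec) v-simp with any? (λ s → (s <? v) ×-dec (IsSimplicial? s ×-dec Adj? s v))
    ... | no ∄s = v , (v-simp , λ s s<v s-simp sv → ∄s (s , s<v , s-simp , sv)) , λ x x∈ → x∈
    ... | yes (s , s<v , s-simp , sv) with go s (rec s<v) s-simp
    ...   | t , t-leader , N[s]⊆N[t] =
      t , t-leader , λ x x∈N[v] → N[s]⊆N[t] x (simplicial⇒nbhd⊆ v-simp (inj₂ (Adj-sym sv)) x x∈N[v])

  leaders-stable : IsStable G (subset IsLeader?)
  leaders-stable u v u∈ v∈ uv with ∈-subset⁻ IsLeader? u∈ | ∈-subset⁻ IsLeader? v∈ | <-cmp u v
  ... | u-simp , _ | _ , v-leads | tri< u<v _ _ = v-leads u u<v u-simp uv
  ... | _ | _ | tri≈ _ refl _ = Adj-irrefl uv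
  ... | _ , u-leads | v-simp , _ | tri> _ _ v<u = u-leads v v<u v-simp (Adj-sym uv)

  simplicial⇒nbhd-isClique : ∀ {t} → IsSimplicial G t → IsClique G (subset (InClosedNbhd? t))
  simplicial⇒nbhd-isClique {t} t-simp u v u∈ v∈ =
    t-simp u v (∈-subset⁻ (InClosedNbhd? t) u∈) (∈-subset⁻ (InClosedNbhd? t) v∈)

lemma8 : (n : ℕ) (G : Graph n) → IsCliqueSimplicial G →
    (a w : ℕ) → IsStabilityNumber G a → IsCliqueNumber G w → n ≤ a * w
lemma8 n G cs a w (_ , α-maximum) (_ , ω-maximum) = ≤-trans
  (covering⇒n≤∣T∣*w leaders nbhd covered nbhd-small)
  (*-monoˡ-≤ w (α-maximum leaders (leaders-stable G)))
  where
  leaders : Subset n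
  leaders = subset (IsLeader? G)
  nbhd : Fin n → Subset n
  nbhd t = subset (InClosedNbhd? G t)
  covered : ∀ x → ∃ λ t → t ∈ leaders × x ∈ nbhd t
  covered x with cliqueSimplicial⇒∈-simplicialNbhd G cs x
  ... | v , v-simp , x∈N[v] with leader-above G v v-simp
  ...   | t , t-leader , N[v]⊆N[t] =
    t , ∈-subset⁺ (IsLeader? G) t-leader , ∈-subset⁺ (InClosedNbhd? G t) (N[v]⊆N[t] x x∈N[v])
  nbhd-small : ∀ {t} → t ∈ leaders → ∣ nbhd t ∣ ≤ w
  nbhd-small t∈L = ω-maximum _ (simplicial⇒nbhd-isClique G (proj₁ (∈-subset⁻ (IsLeader? G) t∈L)))
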